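{- Let $n\geq 1$, let $A$ be an arbitrary collection of subsets of $[n]$ of even cardinality, and let $O$ be the collection of all subsets of $[n]$ of odd cardinality. Then $A\cup O$ is the collection of feasible sets of a delta-matroid with ground set $[n]$.
   Context: $[n]=\{1,\dots,n\}$. A delta-matroid $(E,\mathcal F)$ consists of a finite set $E$ and a non-empty collection $\mathcal F$ of subsets of $E$ satisfying: for all $X,Y\in\mathcal F$ and every $e\in X\bigtriangleup Y$ there exists $f\in X\bigtriangleup Y$ (possibly $f=e$) with $X\bigtriangleup\{e,f\}\in\mathcal F$. -}

module Defs where

open import Data.Nat using (ℕ; _%_)
open import Data.Fin using (Fin)
open import Data.Fin.Subset using (Subset; _∪_; _─_; ⁅_⁆; _∈_; ∣_∣)
open import Data.Product using (∃; ∃-syntax; _×_)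
open import Data.Sum using (_⊎_)
open import Relation.Binary.PropositionalEquality using (_≡_)
open import Level using (Level; _⊔_)

_△_ : ∀ {n} → Subset n → Subset n → Subset n
X △ Y = (X ─ Y) ∪ (Y ─ X)

EvenCard : ∀ {n} → Subset n → Set
EvenCard X = ∣ X ∣ % 2 ≡ 0

OddCard : ∀ {n} → Subset n → Set
OddCard X = ∣ X ∣ % 2 ≡ 1

IsDeltaMatroid : ∀ {ℓ} (n : ℕ) → (Subset n → Set ℓ) → Set ℓ
IsDeltaMatroid n F =
  (∃[ X ] F X) ×
  (∀ (X Y : Subset n) → F X → F Y → ∀ (e : Fin n) → e ∈ (X △ Y) →
     ∃[ f ] (f ∈ (X △ Y) × F (X △ (⁅ e ⁆ ∪ ⁅ f ⁆))))

_∪ᶜ_ : ∀ {n ℓ ℓ'} → (Subset n → Set ℓ) → (Subset n → Set ℓ') → Subset n → Set (ℓ ⊔ ℓ')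
(A ∪ᶜ B) X = A X ⊎ B X

-- A collection containing every odd set already satisfies the exchange axiom.
-- Given feasible Y and e ∈ X △ Y: if |X| is even, X △ {e} is odd; if |X| is odd
-- and X △ Y contains some f ≠ e, then X △ {e, f} is odd; otherwise X △ Y = {e},
-- so X △ {e} = Y is feasible.
module Submission where

open import Defs
open import Data.Bool using (Bool; true; false; _xor_)
open import Data.Bool.Properties using (not-involutive)
open import Data.Empty using (⊥-elim)
open import Data.Fin using (Fin; zero; _≟_)
open import Data.Fin.Properties using (any?)
open import Data.Fin.Subset using (Subset; _∪_; ⁅_⁆; _∈_; _∉_; _⊆_; ∣_∣; inside; outside)
open import Data.Fin.Subset.Properties using (_∈?_; ∪-idem; ⊆-antisym; ∣⁅x⁆∣≡1; x∈⁅y⁆⇒x≡y; x∈⁅x⁆)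
open import Data.Nat using (ℕ; suc; _≥_; _%_; parity)
open import Data.Parity.Base as ℙ using (Parity; 0ℙ; 1ℙ)
open import Data.Parity.Properties using (+-homo-+; +-commutativeSemigroup)
open import Data.Product using (∃-syntax; _×_; _,_)
open import Data.Sum using (_⊎_; inj₁; inj₂)
open import Data.Vec using ([]; _∷_; here; there)
open import Function using (_∘_)
open import Relation.Nullary using (yes; no)
open import Relation.Nullary.Decidable using (_×-dec_; ¬?)
open import Relation.Binary.PropositionalEquality
open import Algebra.Properties.CommutativeSemigroup +-commutativeSemigroup using (interchange)

private
  variable
    n : ℕ

parityᵇ : Bool → Parity
parityᵇ false = 0ℙ
parityᵇ true  = 1ℙ

parity-∣∷∣ : ∀ x (X : Subset n) → parity ∣ x ∷ X ∣ ≡ parityᵇ x ℙ.+ parity ∣ X ∣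
parity-∣∷∣ inside  X = +-homo-+ 1 ∣ X ∣
parity-∣∷∣ outside X = refl

△-∷ : ∀ x y (X Y : Subset n) → (x ∷ X) △ (y ∷ Y) ≡ (x xor y) ∷ (X △ Y)
△-∷ true  true  X Y = refl
△-∷ true  false X Y = refl
△-∷ false true  X Y = refl
△-∷ false false X Y = refl

parityᵇ-xor : ∀ x y → parityᵇ (x xor y) ≡ parityᵇ x ℙ.+ parityᵇ y
parityᵇ-xor true  true  = refl
parityᵇ-xor true  false = refl
parityᵇ-xor false y     = refl

parity-∣△∣ : (X Y : Subset n) → parity ∣ X △ Y ∣ ≡ parity ∣ X ∣ ℙ.+ parity ∣ Y ∣
parity-∣△∣ [] [] = refl
parity-∣△∣ (x ∷ X) (y ∷ Y) = begin
  parity ∣ (x ∷ X) △ (y ∷ Y) ∣                     ≡⟨ cong (parity ∘ ∣_∣) (△-∷ x y X Y) ⟩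
  parity ∣ (x xor y) ∷ (X △ Y) ∣                   ≡⟨ parity-∣∷∣ (x xor y) (X △ Y) ⟩
  parityᵇ (x xor y) ℙ.+ parity ∣ X △ Y ∣           ≡⟨ cong₂ ℙ._+_ (parityᵇ-xor x y) (parity-∣△∣ X Y) ⟩
  (px ℙ.+ py) ℙ.+ (parity ∣ X ∣ ℙ.+ parity ∣ Y ∣) ≡⟨ interchange px py _ _ ⟩
  (px ℙ.+ parity ∣ X ∣) ℙ.+ (py ℙ.+ parity ∣ Y ∣) ≡⟨ sym (cong₂ ℙ._+_ (parity-∣∷∣ x X) (parity-∣∷∣ y Y)) ⟩
  parity ∣ x ∷ X ∣ ℙ.+ parity ∣ y ∷ Y ∣             ∎
  where
  open ≡-Reasoning
  px = parityᵇ x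
  py = parityᵇ y

-- The builtin _%_ reduces suc (suc m) % 2 to m % 2 definitionally.
parity≡1ℙ⇒%2≡1 : ∀ m → parity m ≡ 1ℙ → m % 2 ≡ 1
parity≡1ℙ⇒%2≡1 1             _  = refl
parity≡1ℙ⇒%2≡1 (suc (suc m)) eq = parity≡1ℙ⇒%2≡1 m eq

△-cancelˡ : (X Y : Subset n) → X △ (X △ Y) ≡ Y
△-cancelˡ [] [] = refl
△-cancelˡ (x ∷ X) (y ∷ Y) = begin
  (x ∷ X) △ ((x ∷ X) △ (y ∷ Y)) ≡⟨ cong ((x ∷ X) △_) (△-∷ x y X Y) ⟩
  (x ∷ X) △ ((x xor y) ∷ (X △ Y)) ≡⟨ △-∷ x (x xor y) X (X △ Y) ⟩
  (x xor (x xor y)) ∷ (X △ (X △ Y)) ≡⟨ cong₂ _∷_ (xor-cancelˡ x y) (△-cancelˡ X Y) ⟩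
  y ∷ Y                           ∎
  where
  open ≡-Reasoning
  xor-cancelˡ : ∀ x y → x xor (x xor y) ≡ y
  xor-cancelˡ true  y = not-involutive y
  xor-cancelˡ false y = refl

∪≡△ : (X Y : Subset n) → (∀ {z} → z ∈ X → z ∉ Y) → X ∪ Y ≡ X △ Y
∪≡△ [] [] _ = refl
∪≡△ (inside  ∷ X) (inside  ∷ Y) disj = ⊥-elim (disj here here)
∪≡△ (inside  ∷ X) (outside ∷ Y) disj = cong (inside ∷_) (∪≡△ X Y (λ z∈X z∈Y → disj (there z∈X) (there z∈Y)))
∪≡△ (outside ∷ X) (inside  ∷ Y) disj = cong (inside ∷_) (∪≡△ X Y (λ z∈X z∈Y → disj (there z∈X) (there z∈Y)))
∪≡△ (outside ∷ X) (outside ∷ Y) disj = cong (outside ∷_) (∪≡△ X Y (λ z∈X z∈Y → disj (there z∈X) (there z∈Y)))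

parity-∣⁅x⁆∣ : (x : Fin n) → parity ∣ ⁅ x ⁆ ∣ ≡ 1ℙ
parity-∣⁅x⁆∣ x = cong parity (∣⁅x⁆∣≡1 x)

odd-⁅x⁆ : (x : Fin n) → OddCard ⁅ x ⁆
odd-⁅x⁆ x = parity≡1ℙ⇒%2≡1 ∣ ⁅ x ⁆ ∣ (parity-∣⁅x⁆∣ x)

parity-∣⁅x⁆∪⁅x⁆∣ : (x : Fin n) → parity ∣ ⁅ x ⁆ ∪ ⁅ x ⁆ ∣ ≡ 1ℙ
parity-∣⁅x⁆∪⁅x⁆∣ x = trans (cong (parity ∘ ∣_∣) (∪-idem ⁅ x ⁆)) (parity-∣⁅x⁆∣ x)

parity-∣⁅x⁆∪⁅y⁆∣ : {x y : Fin n} → x ≢ y → parity ∣ ⁅ x ⁆ ∪ ⁅ y ⁆ ∣ ≡ 0ℙ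
parity-∣⁅x⁆∪⁅y⁆∣ {x = x} {y} x≢y = begin
  parity ∣ ⁅ x ⁆ ∪ ⁅ y ⁆ ∣             ≡⟨ cong (parity ∘ ∣_∣) (∪≡△ ⁅ x ⁆ ⁅ y ⁆ disjoint) ⟩
  parity ∣ ⁅ x ⁆ △ ⁅ y ⁆ ∣             ≡⟨ parity-∣△∣ ⁅ x ⁆ ⁅ y ⁆ ⟩
  parity ∣ ⁅ x ⁆ ∣ ℙ.+ parity ∣ ⁅ y ⁆ ∣ ≡⟨ cong₂ ℙ._+_ (parity-∣⁅x⁆∣ x) (parity-∣⁅x⁆∣ y) ⟩
  0ℙ                                   ∎
  where
  open ≡-Reasoning
  disjoint : ∀ {z} → z ∈ ⁅ x ⁆ → z ∉ ⁅ y ⁆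
  disjoint z∈⁅x⁆ z∈⁅y⁆ = x≢y (trans (sym (x∈⁅y⁆⇒x≡y x z∈⁅x⁆)) (x∈⁅y⁆⇒x≡y y z∈⁅y⁆))

≡⁅x⁆⊎∃≢x : (Z : Subset n) {x : Fin n} → x ∈ Z → Z ≡ ⁅ x ⁆ ⊎ ∃[ y ] (y ∈ Z × y ≢ x)
≡⁅x⁆⊎∃≢x Z {x} x∈Z with any? (λ y → (y ∈? Z) ×-dec ¬? (y ≟ x))
... | yes other = inj₂ other
... | no ∄other = inj₁ (⊆-antisym Z⊆⁅x⁆ ⁅x⁆⊆Z)
  where
  Z⊆⁅x⁆ : Z ⊆ ⁅ x ⁆
  Z⊆⁅x⁆ {y} y∈Z with y ≟ x
  ... | yes refl = x∈⁅x⁆ x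
  ... | no y≢x   = ⊥-elim (∄other (y , y∈Z , y≢x))
  ⁅x⁆⊆Z : ⁅ x ⁆ ⊆ Z
  ⁅x⁆⊆Z y∈⁅x⁆ = subst (_∈ Z) (sym (x∈⁅y⁆⇒x≡y x y∈⁅x⁆)) x∈Z

odd-△ : (X Z : Subset n) → parity ∣ X ∣ ℙ.+ parity ∣ Z ∣ ≡ 1ℙ → OddCard (X △ Z)
odd-△ X Z p = parity≡1ℙ⇒%2≡1 ∣ X △ Z ∣ (trans (parity-∣△∣ X Z) p)

exchange-⊇odd : ∀ {ℓ} (F : Subset n → Set ℓ) → (∀ X → OddCard X → F X) →
  ∀ X Y → F Y → ∀ e → e ∈ (X △ Y) → ∃[ f ] (f ∈ (X △ Y) × F (X △ (⁅ e ⁆ ∪ ⁅ f ⁆)))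
exchange-⊇odd F odd⇒F X Y FY e e∈X△Y with parity ∣ X ∣ in pX | ≡⁅x⁆⊎∃≢x (X △ Y) e∈X△Y
... | 0ℙ | _ = e , e∈X△Y ,
  odd⇒F _ (odd-△ X (⁅ e ⁆ ∪ ⁅ e ⁆) (cong₂ ℙ._+_ pX (parity-∣⁅x⁆∪⁅x⁆∣ e)))
... | 1ℙ | inj₂ (f , f∈X△Y , f≢e) = f , f∈X△Y ,
  odd⇒F _ (odd-△ X (⁅ e ⁆ ∪ ⁅ f ⁆) (cong₂ ℙ._+_ pX (parity-∣⁅x⁆∪⁅y⁆∣ (f≢e ∘ sym))))
... | 1ℙ | inj₁ X△Y≡⁅e⁆ = e , e∈X△Y , subst F (sym X△⁅e⁆∪⁅e⁆≡Y) FY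
  where
  open ≡-Reasoning
  X△⁅e⁆∪⁅e⁆≡Y : X △ (⁅ e ⁆ ∪ ⁅ e ⁆) ≡ Y
  X△⁅e⁆∪⁅e⁆≡Y = begin
    X △ (⁅ e ⁆ ∪ ⁅ e ⁆) ≡⟨ cong (X △_) (∪-idem ⁅ e ⁆) ⟩
    X △ ⁅ e ⁆           ≡⟨ cong (X △_) (sym X△Y≡⁅e⁆) ⟩
    X △ (X △ Y)         ≡⟨ △-cancelˡ X Y ⟩
    Y                   ∎

isDeltaMatroid-⊇odd : ∀ {ℓ n} (F : Subset (suc n) → Set ℓ) → (∀ X → OddCard X → F X) →
  IsDeltaMatroid (suc n) F
isDeltaMatroid-⊇odd {n = n} F odd⇒F =
  (⁅ zero ⁆ , odd⇒F ⁅ zero ⁆ (odd-⁅x⁆ {suc n} zero)) ,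
  (λ X Y _ → exchange-⊇odd F odd⇒F X Y)

corollary5 : (n : ℕ) → n ≥ 1 → (A : Subset n → Set) → (∀ X → A X → EvenCard X) →
    IsDeltaMatroid n (A ∪ᶜ OddCard)
corollary5 (suc n) _ A _ = isDeltaMatroid-⊇odd (A ∪ᶜ OddCard) (λ _ → inj₂)
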